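{- Let $(G,\mathcal C)$ be an edge-colored graph with conflict graph $H$ and color-intersection graph $\Gamma$; for each block $B$ of $\Gamma$ let $H_B=H[\{e\in E(G): c(e)\in V(B)\}]$. For every $F\subseteq\mathcal C$, $H-S(F)$ is chordal if and only if $H_B-S(F\cap V(B))$ is chordal for every block $B$ of $\Gamma$.
   Context: An edge-colored graph $(G,\mathcal C)$: finite simple graph $G=(V,E)$ with a partition $\mathcal C$ of $E$ into color classes; $c(e)$ is the color of $e$. Conflict graph $H$: vertex set $E$, $e\ne f$ adjacent iff they share an endpoint or have the same color. Color-intersection graph $\Gamma$: vertex set $\mathcal C$, two distinct colors adjacent iff some edge of one color shares an endpoint with some edge of the other. $S(F)$: edges with colors in $F$. -}

module Defs where

open import Data.Nat using (ℕ; suc; _+_; _<?_)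
open import Data.Fin using (Fin; zero; suc; toℕ; fromℕ<)
open import Data.Fin.Subset using (Subset; _∈_; _∉_; _⊆_; _-_; Nonempty)
open import Data.Product using (Σ; ∃; _×_; _,_)
open import Data.Sum using (_⊎_)
open import Relation.Binary.PropositionalEquality using (_≡_; _≢_)
open import Relation.Nullary using (yes; no)

-- An edge-colored finite simple graph: vertices Fin n, edges Fin m
-- (each edge given by its two distinct endpoints, no parallel edges),
-- colors Fin k; the coloring is surjective, so the color classes
-- form a partition of E into nonempty classes.
record ECGraph : Set where
  field
    n m k    : ℕ
    end₁ end₂ : Fin m → Fin n
    loopless : ∀ e → end₁ e ≢ end₂ e
    simple   : ∀ e f → ((end₁ e ≡ end₁ f × end₂ e ≡ end₂ f) ⊎ (end₁ e ≡ end₂ f × end₂ e ≡ end₁ f)) → e ≡ f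
    col      : Fin m → Fin k
    col-surj : ∀ (i : Fin k) → ∃ λ e → col e ≡ i

  Incident : Fin m → Fin n → Set
  Incident e v = end₁ e ≡ v ⊎ end₂ e ≡ v

  ShareEnd : Fin m → Fin m → Set
  ShareEnd e f = ∃ λ v → Incident e v × Incident f v

  HAdj : Fin m → Fin m → Set
  HAdj e f = e ≢ f × (ShareEnd e f ⊎ col e ≡ col f)

  ΓAdj : Fin k → Fin k → Set
  ΓAdj i j = i ≢ j × Σ (Fin m) λ e → Σ (Fin m) λ f → col e ≡ i × col f ≡ j × ShareEnd e f

next : ∀ {l} → Fin (suc l) → Fin (suc l)
next {l} i with toℕ i <? l
... | yes p = suc (fromℕ< p)
... | no _  = zero

Chordal : ∀ {m} → (Fin m → Fin m → Set) → (Fin m → Set) → Set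
Chordal {m} Adj X =
  ∀ (r : ℕ) (v : Fin (4 + r) → Fin m) →
  (∀ {i j} → v i ≡ v j → i ≡ j) →
  (∀ i → X (v i)) →
  (∀ i → Adj (v i) (v (next i))) →
  Σ (Fin (4 + r)) λ i → Σ (Fin (4 + r)) λ j →
    i ≢ j × next i ≢ j × next j ≢ i × Adj (v i) (v j)

data Reach {k} (Adj : Fin k → Fin k → Set) (X : Subset k) : Fin k → Fin k → Set where
  here : ∀ {x} → x ∈ X → Reach Adj X x x
  step : ∀ {x y z} → x ∈ X → Adj x y → Reach Adj X y z → Reach Adj X x z

-- the induced subgraph on X is connected (the empty graph counts as connected)
Connected : ∀ {k} → (Fin k → Fin k → Set) → Subset k → Set
Connected Adj X = ∀ u v → u ∈ X → v ∈ X → Reach Adj X u v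

NoCut : ∀ {k} → (Fin k → Fin k → Set) → Subset k → Set
NoCut Adj X = ∀ v → v ∈ X → Connected Adj (X - v)

Block : ∀ {k} → (Fin k → Fin k → Set) → Subset k → Set
Block Adj B = Nonempty B × Connected Adj B × NoCut Adj B ×
  (∀ Y → B ⊆ Y → Connected Adj Y → NoCut Adj Y → Y ⊆ B)

-- Take a cycle of length at least four in H − S(F) without a chord. Two of its edges of the
-- same colour would form a chord unless they are consecutive, so each colour occupies at most
-- two consecutive positions. Consecutive edges have equal or Γ-adjacent colours, so walking
-- around the cycle shows that its set of colours is connected in Γ, and since deleting one
-- colour removes at most two consecutive positions, what remains is still traversed by an
-- arc of the cycle. Thus the colours of the cycle induce a connected subgraph of Γ without
-- a cut vertex, which lies in some block B, and the cycle is a chordless cycle of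
-- H_B − S(F ∩ B). The converse holds because H_B − S(F ∩ B) is an induced subgraph of H − S(F).

module Submission where

open import Defs
open import Data.Bool.Properties using (T-≡)
open import Data.Empty using (⊥-elim)
open import Data.Fin using (Fin; zero; suc; toℕ; fromℕ; _≤_; _<_)
open import Data.Fin.Properties
  using (_≟_; _≤?_; any?; toℕ-fromℕ; toℕ-fromℕ<; toℕ-injective; toℕ≤pred[n]; ≤-total; ≤∧≢⇒<; <⇒≢)
open import Data.Fin.Subset using (Subset; _∈_; _∉_; _∩_; _-_; _⊆_; _⊃_; Nonempty)
open import Data.Fin.Subset.Induction using (Acc; acc; ⊃-wellFounded)
open import Data.Fin.Subset.Properties using (_∈?_; x∈p∧x≢y⇒x∈p-y; p─q⊆p; x∈p∩q⁺; x∈p∩q⁻)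
open import Data.Nat as ℕ using (ℕ; suc; _<?_)
import Data.Nat.Properties as ℕ
open import Data.Product using (_×_; Σ; ∃; _,_; proj₁; proj₂)
open import Data.Sum using (_⊎_; inj₁; inj₂; [_,_]′)
open import Data.Vec using (_∷_; tabulate)
open import Data.Vec.Base using (there)
open import Data.Vec.Properties using (lookup∘tabulate; []=⇒lookup; lookup⇒[]=)
open import Function using (_∘_; id)
open import Function.Bundles using (_⇔_; mk⇔; Equivalence)
open import Relation.Nullary using (¬_; Dec; yes; no)
open import Relation.Nullary.Decidable using (¬?; _×-dec_; _⊎-dec_; isYes; fromWitness; toWitness; decidable-stable)
open import Relation.Binary.PropositionalEquality using (_≡_; _≢_; refl; sym; trans; cong; subst)

module _ {k} {A : Fin k → Fin k → Set} {X : Subset k} where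

  reach-trans : ∀ {x y z} → Reach A X x y → Reach A X y z → Reach A X x z
  reach-trans (here _)       q = q
  reach-trans (step x∈ a r) q = step x∈ a (reach-trans r q)

  reach-source : ∀ {x y} → Reach A X x y → x ∈ X
  reach-source (here x∈)     = x∈
  reach-source (step x∈ _ _) = x∈

  reach-sym : (∀ {x y} → A x y → A y x) → ∀ {x y} → Reach A X x y → Reach A X y x
  reach-sym sym-A (here x∈)     = here x∈
  reach-sym sym-A (step x∈ a r) =
    reach-trans (reach-sym sym-A r) (step (reach-source r) (sym-A a) (here x∈))

x∉p-x : ∀ {n} {p : Subset n} x → x ∉ p - x
x∉p-x {p = _ ∷ _} zero    ()
x∉p-x {p = _ ∷ _} (suc x) (there x∈) = x∉p-x x x∈

x∈p-y⇒x≢y : ∀ {n} {p : Subset n} {x y} → x ∈ p - y → x ≢ y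
x∈p-y⇒x≢y x∈ refl = x∉p-x _ x∈

image : ∀ {l k} → (Fin l → Fin k) → Subset k
image a = tabulate λ c → isYes (any? λ i → a i ≟ c)

module _ {l k} (a : Fin l → Fin k) where

  ∈-image⁺ : ∀ i → a i ∈ image a
  ∈-image⁺ i = lookup⇒[]= (a i) (image a)
    (trans (lookup∘tabulate _ (a i)) (Equivalence.to T-≡ (fromWitness (i , refl))))

  ∈-image⁻ : ∀ {c} → c ∈ image a → ∃ λ i → a i ≡ c
  ∈-image⁻ {c} c∈ = toWitness {a? = any? λ i → a i ≟ c}
    (Equivalence.from T-≡ (trans (sym (lookup∘tabulate _ c)) ([]=⇒lookup c∈)))

module _ {k} (A : Fin k → Fin k → Set) where

  private
    extend : ∀ {Y} → Acc _⊃_ Y → Nonempty Y → Connected A Y → NoCut A Y →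
             ¬ ¬ (∃ λ B → Block A B × Y ⊆ B)
    extend {Y} (acc larger) nonempty connected noCut noBlock =
      noBlock (Y , (nonempty , connected , noCut , maximal) , id)
      where
      maximal : ∀ Y′ → Y ⊆ Y′ → Connected A Y′ → NoCut A Y′ → Y′ ⊆ Y
      maximal Y′ Y⊆Y′ connected′ noCut′ {x} x∈Y′ with x ∈? Y
      ... | yes x∈Y = x∈Y
      ... | no  x∉Y = ⊥-elim (extend (larger (Y⊆Y′ , x , x∈Y′ , x∉Y)) (x , x∈Y′) connected′ noCut′
                        λ (B , block , Y′⊆B) → noBlock (B , block , Y′⊆B ∘ Y⊆Y′))

  block-above : ∀ C → Nonempty C → Connected A C → NoCut A C → ¬ ¬ (∃ λ B → Block A B × C ⊆ B)
  block-above C = extend (⊃-wellFounded C)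

module _ {l : ℕ} where

  next-cases : ∀ (i : Fin (suc l)) → toℕ (next i) ≡ suc (toℕ i) ⊎ (next i ≡ zero × toℕ i ≡ l)
  next-cases i with toℕ i <? l
  ... | yes i<l = inj₁ (cong suc (toℕ-fromℕ< i<l))
  ... | no  i≮l = inj₂ (refl , ℕ.≤-antisym (toℕ≤pred[n] i) (ℕ.≮⇒≥ i≮l))

  next-fromℕ : next (fromℕ l) ≡ zero
  next-fromℕ with toℕ (fromℕ l) <? l
  ... | yes l<l = ⊥-elim (ℕ.<-irrefl (toℕ-fromℕ l) l<l)
  ... | no  _   = refl

  NonConsecutive : Fin (suc l) → Fin (suc l) → Set
  NonConsecutive i j = i ≢ j × next i ≢ j × next j ≢ i

  nonConsecutive : ∀ {p m q o : Fin (suc l)} → p < m → m < q → o < p ⊎ q < o → NonConsecutive p q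
  nonConsecutive {p} {m} {q} {o} p<m m<q o-outside = <⇒≢ p<q , next-p≢q , next-q≢p
    where
    p<q : p < q
    p<q = ℕ.<-trans p<m m<q

    next-p≢q : next p ≢ q
    next-p≢q with next-cases p
    ... | inj₁ next-p≡1+p = λ next-p≡q → ℕ.<-irrefl (trans (sym next-p≡1+p) (cong toℕ next-p≡q))
                                           (ℕ.≤-<-trans p<m m<q)
    ... | inj₂ (next-p≡0 , _) = λ next-p≡q → ℕ.<⇒≢ (ℕ.≤-<-trans ℕ.z≤n m<q)
                                           (cong toℕ (trans (sym next-p≡0) next-p≡q))

    next-q≢p : next q ≢ p
    next-q≢p with next-cases q
    ... | inj₁ next-q≡1+q = λ next-q≡p → ℕ.<-asym p<q
          (subst (toℕ q ℕ.<_) (trans (sym next-q≡1+q) (cong toℕ next-q≡p)) (ℕ.n<1+n (toℕ q)))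
    ... | inj₂ (next-q≡0 , q≡l) = λ next-q≡p →
          [ p≢0 , q-last ]′ o-outside (trans (sym next-q≡p) next-q≡0)
      where
      p≢0 : o < p → p ≢ zero
      p≢0 o<p p≡0 = ℕ.<⇒≢ (ℕ.≤-<-trans ℕ.z≤n o<p) (cong toℕ (sym p≡0))
      q-last : q < o → p ≢ zero
      q-last q<o _ = ℕ.<⇒≱ q<o (subst (toℕ o ℕ.≤_) (sym q≡l) (toℕ≤pred[n] o))

module CyclicWalk {k l} (A : Fin k → Fin k → Set) (sym-A : ∀ {x y} → A x y → A y x)
                  (a : Fin (suc l) → Fin k)
                  (walk : ∀ i → a i ≡ a (next i) ⊎ A (a i) (a (next i))) where

  module _ {X : Subset k} where

    reach-next : ∀ {i z} → a i ∈ X → Reach A X (a (next i)) z → Reach A X (a i) z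
    reach-next {i} {z} ai∈ r with walk i
    ... | inj₁ ai≡a-next = subst (λ x → Reach A X x z) (sym ai≡a-next) r
    ... | inj₂ adjacent  = step ai∈ adjacent r

    reach-arc : ∀ {i j} → i ≤ j → (∀ t → i ≤ t → t ≤ j → a t ∈ X) → Reach A X (a i) (a j)
    reach-arc {i} {j} i≤j = go (toℕ j ℕ.∸ toℕ i) i (ℕ.m∸n+n≡m i≤j)
      where
      go : ∀ gap i → gap ℕ.+ toℕ i ≡ toℕ j → (∀ t → i ≤ t → t ≤ j → a t ∈ X) → Reach A X (a i) (a j)
      go ℕ.zero i i≡j on-arc with refl ← toℕ-injective i≡j = here (on-arc i ℕ.≤-refl ℕ.≤-refl)
      go (suc gap) i gap+i≡j on-arc with next-cases i
      ... | inj₁ next-i≡1+i =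
        reach-next (on-arc i ℕ.≤-refl (ℕ.m+n≤o⇒n≤o (suc gap) (ℕ.≤-reflexive gap+i≡j)))
          (go gap (next i) (trans (cong (gap ℕ.+_) next-i≡1+i) (trans (ℕ.+-suc gap (toℕ i)) gap+i≡j))
             λ t next-i≤t → on-arc t (ℕ.≤-trans (ℕ.n≤1+n (toℕ i)) (subst (ℕ._≤ toℕ t) next-i≡1+i next-i≤t)))
      ... | inj₂ (_ , i≡l) = ⊥-elim (ℕ.<⇒≱ l<j (toℕ≤pred[n] j))
        where
        l<j : l ℕ.< toℕ j
        l<j = subst (l ℕ.<_) gap+i≡j (ℕ.s≤s (subst (ℕ._≤ gap ℕ.+ toℕ i) i≡l (ℕ.m≤n+m (toℕ i) gap)))

    reach-wrap : ∀ {i j} → (∀ t → t ≤ i ⊎ j ≤ t → a t ∈ X) → Reach A X (a j) (a i)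
    reach-wrap {i} {j} off-arc =
      reach-trans (reach-arc j≤last λ t j≤t _ → off-arc t (inj₂ j≤t))
        (reach-next (off-arc (fromℕ l) (inj₂ j≤last))
          (subst (λ p → Reach A X (a p) (a i)) (sym next-fromℕ)
            (reach-arc ℕ.z≤n λ t _ t≤i → off-arc t (inj₁ t≤i))))
      where
      j≤last : j ≤ fromℕ l
      j≤last = subst (toℕ j ℕ.≤_) (sym (toℕ-fromℕ l)) (toℕ≤pred[n] j)

  connected-image : ∀ Y → Y ⊆ image a →
                    (∀ {i j} → i ≤ j → a i ∈ Y → a j ∈ Y → Reach A Y (a i) (a j)) →
                    Connected A Y
  connected-image Y Y⊆image reach u w u∈Y w∈Y
    with ∈-image⁻ a (Y⊆image u∈Y) | ∈-image⁻ a (Y⊆image w∈Y)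
  ... | i , refl | j , refl with ≤-total i j
  ... | inj₁ i≤j = reach i≤j u∈Y w∈Y
  ... | inj₂ j≤i = reach-sym sym-A (reach j≤i w∈Y u∈Y)

  image-connected : Connected A (image a)
  image-connected = connected-image (image a) id λ i≤j _ _ → reach-arc i≤j λ t _ _ → ∈-image⁺ a t

  module _ (repeats-consecutively : ∀ {i j} → NonConsecutive i j → a i ≢ a j) where

    image-noCut : NoCut A (image a)
    image-noCut c _ = connected-image (image a - c) (p─q⊆p _ _) around
      where
      avoiding : ∀ t → a t ≢ c → a t ∈ image a - c
      avoiding t = x∈p∧x≢y⇒x∈p-y (∈-image⁺ a t)

      -- If c occurs at some x strictly inside the arc from i to j, it occurs nowhere off that
      -- arc (such a position would be non-consecutive to x), so the complementary arc avoids c.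
      around : ∀ {i j} → i ≤ j → a i ∈ image a - c → a j ∈ image a - c →
               Reach A (image a - c) (a i) (a j)
      around {i} {j} i≤j ai∈ aj∈ with any? (λ x → i ≤? x ×-dec x ≤? j ×-dec a x ≟ c)
      ... | no  no-c-on-arc =
        reach-arc i≤j λ t i≤t t≤j → avoiding t λ at≡c → no-c-on-arc (t , i≤t , t≤j , at≡c)
      ... | yes (x , i≤x , x≤j , ax≡c) =
        reach-sym sym-A (reach-wrap λ t off-arc → avoiding t (c-not-at t off-arc))
        where
        strict : ∀ {p q} → p ≤ q → a p ≢ a q → p < q
        strict p≤q ap≢aq = ≤∧≢⇒< p≤q (ap≢aq ∘ cong a)

        ai≢c : a i ≢ c
        ai≢c = x∈p-y⇒x≢y ai∈

        aj≢c : a j ≢ c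
        aj≢c = x∈p-y⇒x≢y aj∈

        i<x : i < x
        i<x = strict i≤x λ ai≡ax → ai≢c (trans ai≡ax ax≡c)

        x<j : x < j
        x<j = strict x≤j λ ax≡aj → aj≢c (trans (sym ax≡aj) ax≡c)

        c-not-at : ∀ t → t ≤ i ⊎ j ≤ t → a t ≢ c
        c-not-at t (inj₁ t≤i) at≡c =
          repeats-consecutively (nonConsecutive t<i i<x (inj₂ x<j)) (trans at≡c (sym ax≡c))
          where
          t<i : t < i
          t<i = strict t≤i λ at≡ai → ai≢c (trans (sym at≡ai) at≡c)
        c-not-at t (inj₂ j≤t) at≡c =
          repeats-consecutively (nonConsecutive x<j j<t (inj₁ i<x)) (trans ax≡c (sym at≡c))
          where
          j<t : j < t
          j<t = strict j≤t λ aj≡at → aj≢c (trans aj≡at at≡c)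

Chord : ∀ {l m} → (Fin m → Fin m → Set) → (Fin (suc l) → Fin m) → Set
Chord {l} Adj v = Σ (Fin (suc l)) λ i → Σ (Fin (suc l)) λ j →
  i ≢ j × next i ≢ j × next j ≢ i × Adj (v i) (v j)

module ConflictGraph (G : ECGraph) where
  open ECGraph G

  ShareEnd? : ∀ e f → Dec (ShareEnd e f)
  ShareEnd? e f = any? λ x → incident? e x ×-dec incident? f x
    where
    incident? : ∀ e x → Dec (Incident e x)
    incident? e x = end₁ e ≟ x ⊎-dec end₂ e ≟ x

  HAdj? : ∀ e f → Dec (HAdj e f)
  HAdj? e f = ¬? (e ≟ f) ×-dec (ShareEnd? e f ⊎-dec col e ≟ col f)

  chord? : ∀ {l} (v : Fin (suc l) → Fin m) → Dec (Chord HAdj v)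
  chord? v = any? λ i → any? λ j →
    ¬? (i ≟ j) ×-dec ¬? (next i ≟ j) ×-dec ¬? (next j ≟ i) ×-dec HAdj? (v i) (v j)

  ΓAdj-sym : ∀ {c d} → ΓAdj c d → ΓAdj d c
  ΓAdj-sym (c≢d , e , f , ce≡c , cf≡d , x , e∋x , f∋x) =
    c≢d ∘ sym , f , e , cf≡d , ce≡c , x , f∋x , e∋x

  HAdj⇒col≡⊎ΓAdj : ∀ {e f} → HAdj e f → col e ≡ col f ⊎ ΓAdj (col e) (col f)
  HAdj⇒col≡⊎ΓAdj (_ , inj₂ ce≡cf) = inj₁ ce≡cf
  HAdj⇒col≡⊎ΓAdj {e} {f} (_ , inj₁ share) with col e ≟ col f
  ... | yes ce≡cf = inj₁ ce≡cf
  ... | no  ce≢cf = inj₂ (ce≢cf , e , f , refl , refl , share)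

  chordless⇒colours-repeat-consecutively :
    ∀ {l} {v : Fin (suc l) → Fin m} → (∀ {i j} → v i ≡ v j → i ≡ j) → ¬ Chord HAdj v →
    ∀ {i j} → NonConsecutive i j → col (v i) ≢ col (v j)
  chordless⇒colours-repeat-consecutively injective chordless {i} {j}
    (i≢j , next-i≢j , next-j≢i) same-colour =
    chordless (i , j , i≢j , next-i≢j , next-j≢i , i≢j ∘ injective , inj₂ same-colour)

mainTheorem11 : (G : ECGraph) → (F : Subset (ECGraph.k G)) →
    Chordal (ECGraph.HAdj G) (λ e → ECGraph.col G e ∉ F)
    ⇔ (∀ (B : Subset (ECGraph.k G)) → Block (ECGraph.ΓAdj G) B →
    Chordal (ECGraph.HAdj G) (λ e → ECGraph.col G e ∈ B × ECGraph.col G e ∉ (F ∩ B)))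
mainTheorem11 G F = mk⇔ restrict glue
  where
  open ECGraph G
  open ConflictGraph G

  restrict : Chordal HAdj (λ e → col e ∉ F) →
             ∀ B → Block ΓAdj B → Chordal HAdj (λ e → col e ∈ B × col e ∉ (F ∩ B))
  restrict chordal B _ r v injective in-H-B cycle =
    chordal r v injective (λ i c∈F → proj₂ (in-H-B i) (x∈p∩q⁺ (c∈F , proj₁ (in-H-B i)))) cycle

  -- The block containing the colours of a cycle exists only up to double negation, since
  -- connectivity is not decidable here; the chord is recovered because chords are decidable.
  glue : (∀ B → Block ΓAdj B → Chordal HAdj (λ e → col e ∈ B × col e ∉ (F ∩ B))) →
         Chordal HAdj (λ e → col e ∉ F)
  glue chordal-blocks r v injective outside-F cycle = decidable-stable (chord? v) λ chordless →
    let open CyclicWalk ΓAdj ΓAdj-sym (col ∘ v) (HAdj⇒col≡⊎ΓAdj ∘ cycle) in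
    block-above ΓAdj (image (col ∘ v)) (_ , ∈-image⁺ (col ∘ v) zero) image-connected
      (image-noCut (chordless⇒colours-repeat-consecutively injective chordless))
      λ (B , block , colours⊆B) → chordless (chordal-blocks B block r v injective
        (λ i → colours⊆B (∈-image⁺ (col ∘ v) i) , λ c∈F∩B → outside-F i (proj₁ (x∈p∩q⁻ F B c∈F∩B)))
        cycle)
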